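{- Let $M$ be a matroid and $t\in\mathbb{N}$. For every $X\subseteq E(M)$, $r_{M^t}(S_X)=t\cdot r_M(X)$.
   Context: A cyclic flat of a matroid $M$ is a flat $F$ such that $M|F$ has no coloops; $\mathcal{Z}(M)$ denotes the set of cyclic flats, and a matroid is determined by its cyclic flats and their ranks. The $t$-expansion: for each $e\in E(M)$ let $S_e$ be a $t$-element set with $e\in S_e$, the sets $S_e$ pairwise disjoint; for $X\subseteq E(M)$ let $S_X=\bigcup_{e\in X}S_e$. The $t$-expansion $M^t$ is the matroid on $S_{E(M)}$ whose cyclic flats are exactly the sets $S_A$ with $A\in\mathcal{Z}(M)$, with $r_{M^t}(S_A)=t\cdot r_M(A)$. -}

module Defs where

open import Data.Nat using (ℕ; _+_; _*_; _≤_; _<_)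
open import Data.Fin using (Fin; quotient)
open import Data.Fin.Subset using (Subset; _⊆_; _∪_; _∩_; _-_; ⁅_⁆; ∣_∣; _∈_; _∉_)
open import Data.Vec using (tabulate; lookup)
open import Data.Product using (Σ; _×_)
open import Relation.Binary.PropositionalEquality using (_≡_)

record Matroid (n : ℕ) : Set where
  field
    rank       : Subset n → ℕ
    rank-≤card : ∀ X → rank X ≤ ∣ X ∣
    rank-mono  : ∀ {X Y} → X ⊆ Y → rank X ≤ rank Y
    rank-submod : ∀ X Y → rank (X ∪ Y) + rank (X ∩ Y) ≤ rank X + rank Y
open Matroid public

IsFlat : ∀ {n} → Matroid n → Subset n → Set
IsFlat M F = ∀ e → e ∉ F → rank M F < rank M (F ∪ ⁅ e ⁆)

NoColoopsRestr : ∀ {n} → Matroid n → Subset n → Set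
NoColoopsRestr M F = ∀ e → e ∈ F → rank M (F - e) ≡ rank M F

IsCyclicFlat : ∀ {n} → Matroid n → Subset n → Set
IsCyclicFlat M F = IsFlat M F × NoColoopsRestr M F

-- Expansion ground set: S_{E(M)} is Fin (n * t), where S_e is the block
-- { k | quotient t k ≡ e } of size t (k ↔ (e , j) via combine/remQuot).
S[_] : ∀ {n} t → Subset n → Subset (n * t)
S[_] {n} t X = tabulate (λ k → lookup X (quotient {n} t k))

IsExpansion : ∀ {n} (t : ℕ) → Matroid n → Matroid (n * t) → Set
IsExpansion {n} t M N =
  (∀ Z → (IsCyclicFlat N Z → Σ (Subset n) (λ A → IsCyclicFlat M A × Z ≡ S[ t ] A))
       × (∀ A → IsCyclicFlat M A → Z ≡ S[ t ] A → IsCyclicFlat N Z))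
  × (∀ A → IsCyclicFlat M A → rank N (S[ t ] A) ≡ t * rank M A)

-- For every matroid N and every X, r(X) is the minimum of r(F) + |X ─ F| over
-- the cyclic flats F of N. Submodularity gives r(X) ≤ r(Z) + |X ─ Z| for every
-- Z; the minimum is attained because, starting from Z = X, adding an element
-- that does not raise the rank and deleting a coloop never increases
-- r(Z) + |X ─ Z|, and one of the two applies until Z is a cyclic flat.
-- For the t-expansion, S_X ─ S_F = S_(X ─ F) has t times as many elements as
-- X ─ F, and the cyclic flats of Mᵗ are the S_F, so every term of the minimum
-- for S_X in Mᵗ is t times the corresponding term for X in M.
module Submission where

open import Defs
open import Data.Nat using (ℕ; _*_)
open import Data.Fin.Subset using (Subset)
open import Relation.Binary.PropositionalEquality using (_≡_)

open import Data.Nat using (suc; s≤s; _+_; _≤_; _<_)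
open import Data.Nat.Properties
open import Data.Nat.Induction using (<-wellFounded)
open import Data.Bool using (Bool)
open import Data.Fin using (Fin; quotient; splitAt)
open import Data.Fin.Properties using (any?) renaming (_≟_ to _≟ᶠ_)
open import Data.Fin.Subset using (_∪_; _∩_; _─_; _-_; ⁅_⁆; ∣_∣; _∈_; _∉_; _⊆_; ⊤; ⊥; inside; outside)
open import Data.Fin.Subset.Properties
open import Data.Vec using ([]; _∷_; _++_; lookup; replicate; zipWith; there)
open import Data.Vec.Properties using (tabulate-cong; tabulate∘lookup; lookup∘tabulate; lookup-zipWith; lookup-splitAt; lookup-replicate)
open import Data.Product using (∃; _×_; _,_; proj₁)
open import Data.Sum using (_⊎_; inj₁; inj₂)
open import Function using (_on_)
open import Induction.WellFounded using (Acc; acc)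
open import Relation.Binary.Construct.On using (wellFounded)
open import Relation.Nullary using (yes; no; ¬?; _×-dec_)
open import Relation.Binary.PropositionalEquality using (refl; sym; trans; cong; cong₂; module ≡-Reasoning)

x∈p─q⇒x∉q : ∀ {n} {p q : Subset n} {x} → x ∈ p ─ q → x ∉ q
x∈p─q⇒x∉q {p = _ ∷ _} {inside ∷ _}  {Fin.zero}  ()
x∈p─q⇒x∉q {p = _ ∷ _} {outside ∷ _} {Fin.zero}  _          ()
x∈p─q⇒x∉q {p = _ ∷ _} {_ ∷ _}       {Fin.suc x} (there x∈) (there x∈q) = x∈p─q⇒x∉q x∈ x∈q

p─p≡⊥ : ∀ {n} (p : Subset n) → p ─ p ≡ ⊥
p─p≡⊥ []            = refl
p─p≡⊥ (inside ∷ p)  = cong (outside ∷_) (p─p≡⊥ p)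
p─p≡⊥ (outside ∷ p) = cong (outside ∷_) (p─p≡⊥ p)

∣p∪q∣≤∣p∣+∣q∣ : ∀ {n} (p q : Subset n) → ∣ p ∪ q ∣ ≤ ∣ p ∣ + ∣ q ∣
∣p∪q∣≤∣p∣+∣q∣ []            []            = ≤-refl
∣p∪q∣≤∣p∣+∣q∣ (inside ∷ p)  (inside ∷ q)  = s≤s (≤-trans (∣p∪q∣≤∣p∣+∣q∣ p q) (+-monoʳ-≤ ∣ p ∣ (n≤1+n ∣ q ∣)))
∣p∪q∣≤∣p∣+∣q∣ (inside ∷ p)  (outside ∷ q) = s≤s (∣p∪q∣≤∣p∣+∣q∣ p q)
∣p∪q∣≤∣p∣+∣q∣ (outside ∷ p) (inside ∷ q)  = ≤-trans (s≤s (∣p∪q∣≤∣p∣+∣q∣ p q)) (≤-reflexive (sym (+-suc _ _)))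
∣p∪q∣≤∣p∣+∣q∣ (outside ∷ p) (outside ∷ q) = ∣p∪q∣≤∣p∣+∣q∣ p q

∣p─q∪⁅x⁆∣≤∣p─q∣ : ∀ {n} (p q : Subset n) x → ∣ p ─ q ∪ ⁅ x ⁆ ∣ ≤ ∣ p ─ q ∣
∣p─q∪⁅x⁆∣≤∣p─q∣ p q x rewrite sym (p─q─r≡p─q∪r p q ⁅ x ⁆) = ∣p─q∣≤∣p∣ (p ─ q) ⁅ x ⁆

∣p─q∪⁅x⁆∣<∣p─q∣ : ∀ {n} {p q : Subset n} {x} → x ∈ p → x ∉ q → ∣ p ─ q ∪ ⁅ x ⁆ ∣ < ∣ p ─ q ∣
∣p─q∪⁅x⁆∣<∣p─q∣ {p = p} {q} {x} x∈p x∉q rewrite sym (p─q─r≡p─q∪r p q ⁅ x ⁆) =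
  x∈p⇒∣p-x∣<∣p∣ (x∈p∧x∉q⇒x∈p─q x∈p x∉q)

∣p─[q-x]∣≤1+∣p─q∣ : ∀ {n} (p q : Subset n) x → ∣ p ─ (q - x) ∣ ≤ suc ∣ p ─ q ∣
∣p─[q-x]∣≤1+∣p─q∣ p q x = begin
  ∣ p ─ (q - x) ∣       ≤⟨ p⊆q⇒∣p∣≤∣q∣ ⊆p─q∪⁅x⁆ ⟩
  ∣ (p ─ q) ∪ ⁅ x ⁆ ∣   ≤⟨ ∣p∪q∣≤∣p∣+∣q∣ (p ─ q) ⁅ x ⁆ ⟩
  ∣ p ─ q ∣ + ∣ ⁅ x ⁆ ∣ ≡⟨ cong (∣ p ─ q ∣ +_) (∣⁅x⁆∣≡1 x) ⟩
  ∣ p ─ q ∣ + 1         ≡⟨ +-comm _ 1 ⟩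
  suc ∣ p ─ q ∣         ∎
  where
  open ≤-Reasoning
  ⊆p─q∪⁅x⁆ : p ─ (q - x) ⊆ (p ─ q) ∪ ⁅ x ⁆
  ⊆p─q∪⁅x⁆ {y} y∈ with y ≟ᶠ x
  ... | yes refl = x∈p∪q⁺ (inj₂ (x∈⁅x⁆ x))
  ... | no y≢x   = x∈p∪q⁺ (inj₁ (x∈p∧x∉q⇒x∈p─q (p─q⊆p p (q - x) y∈)
                                   (λ y∈q → x∈p─q⇒x∉q y∈ (x∈p∧x≢y⇒x∈p-y y∈q y≢x))))

m<n∧o≤1+p⇒m+o≤n+p : ∀ {m n o p} → m < n → o ≤ suc p → m + o ≤ n + p
m<n∧o≤1+p⇒m+o≤n+p {m} {n} {o} {p} m<n o≤1+p = begin
  m + o       ≤⟨ +-monoʳ-≤ m o≤1+p ⟩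
  m + suc p   ≡⟨ +-suc m p ⟩
  suc m + p   ≤⟨ +-monoˡ-≤ p m<n ⟩
  n + p       ∎
  where open ≤-Reasoning

module _ {m} (N : Matroid m) where

  private
    r : Subset m → ℕ
    r = rank N

  rank≤rank+∣─∣ : ∀ X Z → r X ≤ r Z + ∣ X ─ Z ∣
  rank≤rank+∣─∣ X Z = begin
    r X                                 ≤⟨ rank-mono N X⊆Z∪X─Z ⟩
    r (Z ∪ (X ─ Z))                     ≤⟨ m≤m+n _ _ ⟩
    r (Z ∪ (X ─ Z)) + r (Z ∩ (X ─ Z))   ≤⟨ rank-submod N Z (X ─ Z) ⟩
    r Z + r (X ─ Z)                     ≤⟨ +-monoʳ-≤ (r Z) (rank-≤card N (X ─ Z)) ⟩
    r Z + ∣ X ─ Z ∣                     ∎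
    where
    open ≤-Reasoning
    X⊆Z∪X─Z : X ⊆ Z ∪ (X ─ Z)
    X⊆Z∪X─Z {x} x∈X with x ∈? Z
    ... | yes x∈Z = x∈p∪q⁺ (inj₁ x∈Z)
    ... | no  x∉Z = x∈p∪q⁺ (inj₂ (x∈p∧x∉q⇒x∈p─q x∈X x∉Z))

  flat⊎spanned : ∀ Z → IsFlat N Z ⊎ ∃ λ e → e ∉ Z × r (Z ∪ ⁅ e ⁆) ≤ r Z
  flat⊎spanned Z with any? (λ e → ¬? (e ∈? Z) ×-dec (r (Z ∪ ⁅ e ⁆) ≤? r Z))
  ... | yes spanned  = inj₂ spanned
  ... | no ∄spanned = inj₁ λ e e∉Z → ≰⇒> λ le → ∄spanned (e , e∉Z , le)

  noColoops⊎coloop : ∀ Z → NoColoopsRestr N Z ⊎ ∃ λ e → e ∈ Z × r (Z - e) < r Z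
  noColoops⊎coloop Z with any? (λ e → (e ∈? Z) ×-dec (r (Z - e) <? r Z))
  ... | yes coloop  = inj₂ coloop
  ... | no ∄coloop = inj₁ λ e e∈Z →
    ≤-antisym (rank-mono N (p─q⊆p Z ⁅ e ⁆)) (≮⇒≥ λ lt → ∄coloop (e , e∈Z , lt))

  CyclicFlatWithin : Subset m → ℕ → Set
  CyclicFlatWithin X b = ∃ λ A → IsCyclicFlat N A × r A + ∣ X ─ A ∣ ≤ b

  weaken : ∀ X {b b′} → b ≤ b′ → CyclicFlatWithin X b → CyclicFlatWithin X b′
  weaken _ b≤b′ (A , cyclic , le) = A , cyclic , ≤-trans le b≤b′

  -- Adding a spanned element keeps the rank and shrinks ∣ ⊤ ─ Z ∣; deleting a coloop
  -- lowers the rank, and the factor 2 outweighs the growth of ∣ ⊤ ─ Z ∣ by one.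
  potential : Subset m → ℕ
  potential Z = 2 * r Z + ∣ ⊤ ─ Z ∣

  cyclicFlatWithin-from : ∀ X Z → Acc (_<_ on potential) Z → CyclicFlatWithin X (r Z + ∣ X ─ Z ∣)
  cyclicFlatWithin-from X Z (acc descend) with flat⊎spanned Z
  ... | inj₂ (e , e∉Z , spanned) =
    weaken X (+-mono-≤ spanned (∣p─q∪⁅x⁆∣≤∣p─q∣ X Z e))
      (cyclicFlatWithin-from X (Z ∪ ⁅ e ⁆)
        (descend (+-mono-≤-< (*-monoʳ-≤ 2 spanned) (∣p─q∪⁅x⁆∣<∣p─q∣ ∈⊤ e∉Z))))
  ... | inj₁ flat with noColoops⊎coloop Z
  ...   | inj₁ noColoops        = Z , (flat , noColoops) , ≤-refl
  ...   | inj₂ (e , e∈Z , drops) =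
    weaken X (m<n∧o≤1+p⇒m+o≤n+p drops (∣p─[q-x]∣≤1+∣p─q∣ X Z e))
      (cyclicFlatWithin-from X (Z - e)
        (descend (m<n∧o≤1+p⇒m+o≤n+p 2+2r′≤2r (∣p─[q-x]∣≤1+∣p─q∣ ⊤ Z e))))
    where
    2+2r′≤2r : 2 + 2 * r (Z - e) ≤ 2 * r Z
    2+2r′≤2r = ≤-trans (≤-reflexive (sym (*-suc 2 _))) (*-monoʳ-≤ 2 drops)

  cyclicFlatWithin-rank : ∀ X → CyclicFlatWithin X (r X)
  cyclicFlatWithin-rank X =
    weaken X (≤-reflexive r+∣X─X∣≡r) (cyclicFlatWithin-from X X (wellFounded potential <-wellFounded X))
    where
    r+∣X─X∣≡r : r X + ∣ X ─ X ∣ ≡ r X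
    r+∣X─X∣≡r = begin
      r X + ∣ X ─ X ∣   ≡⟨ cong (λ Y → r X + ∣ Y ∣) (p─p≡⊥ X) ⟩
      r X + ∣ ⊥ {m} ∣   ≡⟨ cong (r X +_) (∣⊥∣≡0 m) ⟩
      r X + 0           ≡⟨ +-identityʳ (r X) ⟩
      r X               ∎
      where open ≡-Reasoning

S[t]-∷ : ∀ {n} t x (Y : Subset n) → S[ t ] (x ∷ Y) ≡ replicate t x ++ S[ t ] Y
S[t]-∷ {n} t x Y = trans (tabulate-cong lookup-S[t]-∷) (tabulate∘lookup (replicate t x ++ S[ t ] Y))
  where
  lookup-S[t]-∷ : ∀ k → lookup (x ∷ Y) (quotient {suc n} t k) ≡ lookup (replicate t x ++ S[ t ] Y) k
  -- quotient {suc n} t k computes by cases on splitAt t k.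
  lookup-S[t]-∷ k rewrite lookup-splitAt t (replicate t x) (S[ t ] Y) k with splitAt t k
  ... | inj₁ i = sym (lookup-replicate i x)
  ... | inj₂ j = sym (lookup∘tabulate _ j)

S[t]-zipWith : ∀ {n} t (f : Bool → Bool → Bool) (X A : Subset n) →
               S[ t ] (zipWith f X A) ≡ zipWith f (S[ t ] X) (S[ t ] A)
S[t]-zipWith {n} t f X A = trans (tabulate-cong lookup-S[t]-zipWith) (tabulate∘lookup _)
  where
  lookup-S[t]-zipWith : ∀ k → lookup (zipWith f X A) (quotient {n} t k)
                              ≡ lookup (zipWith f (S[ t ] X) (S[ t ] A)) k
  lookup-S[t]-zipWith k = begin
    lookup (zipWith f X A) (quotient t k)
      ≡⟨ lookup-zipWith f (quotient t k) X A ⟩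
    f (lookup X (quotient t k)) (lookup A (quotient t k))
      ≡⟨ cong₂ f (lookup∘tabulate _ k) (lookup∘tabulate _ k) ⟨
    f (lookup (S[ t ] X) k) (lookup (S[ t ] A) k)
      ≡⟨ lookup-zipWith f k (S[ t ] X) (S[ t ] A) ⟨
    lookup (zipWith f (S[ t ] X) (S[ t ] A)) k ∎
    where open ≡-Reasoning

∣p++q∣≡∣p∣+∣q∣ : ∀ {a b} (p : Subset a) (q : Subset b) → ∣ p ++ q ∣ ≡ ∣ p ∣ + ∣ q ∣
∣p++q∣≡∣p∣+∣q∣ []            q = refl
∣p++q∣≡∣p∣+∣q∣ (inside ∷ p)  q = cong suc (∣p++q∣≡∣p∣+∣q∣ p q)
∣p++q∣≡∣p∣+∣q∣ (outside ∷ p) q = ∣p++q∣≡∣p∣+∣q∣ p q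

∣S[t]∣ : ∀ {n} t (Y : Subset n) → ∣ S[ t ] Y ∣ ≡ t * ∣ Y ∣
∣S[t]∣ t []      = sym (*-zeroʳ t)
∣S[t]∣ t (x ∷ Y) = begin
  ∣ S[ t ] (x ∷ Y) ∣                   ≡⟨ cong ∣_∣ (S[t]-∷ t x Y) ⟩
  ∣ replicate t x ++ S[ t ] Y ∣        ≡⟨ ∣p++q∣≡∣p∣+∣q∣ (replicate t x) (S[ t ] Y) ⟩
  ∣ replicate t x ∣ + ∣ S[ t ] Y ∣     ≡⟨ cong (∣ replicate t x ∣ +_) (∣S[t]∣ t Y) ⟩
  ∣ replicate t x ∣ + t * ∣ Y ∣        ≡⟨ ∣replicate∣+t*∣Y∣ x ⟩
  t * ∣ x ∷ Y ∣                        ∎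
  where
  open ≡-Reasoning
  ∣replicate∣+t*∣Y∣ : ∀ x → ∣ replicate t x ∣ + t * ∣ Y ∣ ≡ t * ∣ x ∷ Y ∣
  ∣replicate∣+t*∣Y∣ inside  = trans (cong (_+ t * ∣ Y ∣) (∣⊤∣≡n t)) (sym (*-suc t ∣ Y ∣))
  ∣replicate∣+t*∣Y∣ outside = cong (_+ t * ∣ Y ∣) (∣⊥∣≡0 t)

∣S[t]─S[t]∣ : ∀ {n} t (X A : Subset n) → ∣ S[ t ] X ─ S[ t ] A ∣ ≡ t * ∣ X ─ A ∣
∣S[t]─S[t]∣ t X A = trans (cong ∣_∣ (sym (S[t]-zipWith t _ X A))) (∣S[t]∣ t (X ─ A))

lemma3p4 : ∀ {n} (M : Matroid n) (t : ℕ) (Mt : Matroid (n * t)) →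
    IsExpansion t M Mt →
    ∀ (X : Subset n) → rank Mt (S[ t ] X) ≡ t * rank M X
lemma3p4 {n} M t Mt (cyclicFlats , rank-S) X = ≤-antisym upper lower
  where
  open ≤-Reasoning
  S : Subset n → Subset (n * t)
  S = S[ t ]

  expanded-term : ∀ A → IsCyclicFlat M A → rank Mt (S A) + ∣ S X ─ S A ∣ ≡ t * (rank M A + ∣ X ─ A ∣)
  expanded-term A cyclic = trans (cong₂ _+_ (rank-S A cyclic) (∣S[t]─S[t]∣ t X A)) (sym (*-distribˡ-+ t _ _))

  upper : rank Mt (S X) ≤ t * rank M X
  upper with cyclicFlatWithin-rank M X
  ... | A , cyclic , le = begin
    rank Mt (S X)                   ≤⟨ rank≤rank+∣─∣ Mt (S X) (S A) ⟩
    rank Mt (S A) + ∣ S X ─ S A ∣   ≡⟨ expanded-term A cyclic ⟩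
    t * (rank M A + ∣ X ─ A ∣)      ≤⟨ *-monoʳ-≤ t le ⟩
    t * rank M X                    ∎

  lower : t * rank M X ≤ rank Mt (S X)
  lower with cyclicFlatWithin-rank Mt (S X)
  ... | Z , cyclicZ , le with proj₁ (cyclicFlats Z) cyclicZ
  ... | A , cyclic , refl = begin
    t * rank M X                    ≤⟨ *-monoʳ-≤ t (rank≤rank+∣─∣ M X A) ⟩
    t * (rank M A + ∣ X ─ A ∣)      ≡⟨ expanded-term A cyclic ⟨
    rank Mt (S A) + ∣ S X ─ S A ∣   ≤⟨ le ⟩
    rank Mt (S X)                   ∎
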